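{- For an integer $k\ge 2$, let $F_k$ be the graph obtained from the disjoint union of the cycle $x_1x_2\cdots x_{4k}x_1$ and the path $y_2y_3\cdots y_{2k}$ by adding the edge $x_1y_2$ (so $n(F_k)=6k-1$). Then $\chi_\mu(F_k)=2k$.
   Context: For a connected graph $G$ and $S\subseteq V(G)$, two vertices $x,y\in S$ are $S$-visible if there is a shortest $x,y$-path $P$ in $G$ with $V(P)\cap S=\{x,y\}$. $S$ is a mutual-visibility set if any two vertices of $S$ are $S$-visible. A mutual-visibility coloring of $G$ is a partition of $V(G)$ into mutual-visibility sets, and the mutual-visibility chromatic number $\chi_\mu(G)$ is the smallest number of classes in such a partition. -}

module Defs where

open import Data.Nat using (ℕ; zero; suc; _≤_; _*_; _∸_)
open import Data.Fin using (Fin; toℕ)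
open import Data.Sum using (_⊎_; inj₁; inj₂)
open import Data.Product using (Σ; _×_)
open import Data.List using (List; []; _∷_)
open import Data.List.Membership.Propositional using (_∈_)
open import Relation.Binary.PropositionalEquality using (_≡_)

record Graph : Set₁ where
  field
    V : Set
    E : V → V → Set

module _ (G : Graph) where
  open Graph G

  data Walk : V → V → Set where
    [] : ∀ {x} → Walk x x
    _∷_ : ∀ {x y z} → E x y → Walk y z → Walk x z

  len : ∀ {x z} → Walk x z → ℕ
  len [] = 0
  len (_ ∷ w) = suc (len w)

  verts : ∀ {x z} → Walk x z → List V
  verts {x} [] = x ∷ []
  verts {x} (_ ∷ w) = x ∷ verts w

  IsShortest : ∀ {x y} → Walk x y → Set
  IsShortest {x} {y} P = (Q : Walk x y) → len P ≤ len Q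

  Visible : (V → Set) → V → V → Set
  Visible S x y =
    Σ (Walk x y) λ P → IsShortest P ×
      ((v : V) → v ∈ verts P → S v → (v ≡ x) ⊎ (v ≡ y))

  MutualVisibilitySet : (V → Set) → Set
  MutualVisibilitySet S = (x y : V) → S x → S y → Visible S x y

  MVColoring : ℕ → Set
  MVColoring m = Σ (V → Fin m) λ c →
    (i : Fin m) → MutualVisibilitySet (λ v → c v ≡ i)

  ChiMuIs : ℕ → Set
  ChiMuIs m = MVColoring m × ((m' : ℕ) → MVColoring m' → m ≤ m')

-- The graph F_k.  Vertices: inj₁ i is x_{i+1} (i < 4k),
-- inj₂ j is y_{j+2} (j < 2k-1).
FV : ℕ → Set
FV k = Fin (4 * k) ⊎ Fin (2 * k ∸ 1)

data FEdge (k : ℕ) : FV k → FV k → Set where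
  cyc  : ∀ {i j} → toℕ j ≡ suc (toℕ i) → FEdge k (inj₁ i) (inj₁ j)
  wrap : ∀ {i j} → toℕ i ≡ 4 * k ∸ 1 → toℕ j ≡ 0 → FEdge k (inj₁ i) (inj₁ j)
  path : ∀ {i j} → toℕ j ≡ suc (toℕ i) → FEdge k (inj₂ i) (inj₂ j)
  att  : ∀ {i j} → toℕ i ≡ 0 → toℕ j ≡ 0 → FEdge k (inj₁ i) (inj₂ j)

F : ℕ → Graph
F k = record { V = FV k ; E = λ u v → FEdge k u v ⊎ FEdge k v u }

module Submission where

-- A mutual-visibility set S cannot contain vertices u, w together with
-- vertices of S separating u from w. Cutting along pieces of the path and arcs of
-- the cycle, this rules out three path vertices, two path vertices and a cycle vertex,
-- a path vertex and three cycle vertices, and four cycle vertices. So S has weight at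
-- most 4 when path vertices count twice, and the total weight 2(2k - 1) + 4k of F_k
-- needs 2k colours. With indices from 0, give colour n < 2k - 1 to y_n, x_{n+1}, x_{4k-n-1} and colour 2k - 1 to
-- x_0, x_{2k}. Each required shortest path is exhibited explicitly; it is certified
-- shortest by a potential that changes by at most 1 along edges and vanishes at the
-- start, i.e. a lower bound for the distance from it.

open import Defs
open import Data.Empty using (⊥; ⊥-elim)
open import Data.Fin as Fin using (Fin; toℕ; fromℕ; fromℕ<)
open import Data.Fin.Properties using (toℕ-injective; toℕ<n; toℕ-fromℕ; toℕ-fromℕ<)
open import Data.List using (List; []; _∷_; length; filter; allFin)
open import Data.List.Properties using (length-tabulate)
open import Data.List.Membership.Propositional using (_∈_)
open import Data.List.Relation.Unary.All as All using (All; []; _∷_)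
open import Data.List.Relation.Unary.All.Properties using (all-filter; filter⁺; tabulate⁺)
open import Data.List.Relation.Unary.AllPairs using (AllPairs; []; _∷_)
import Data.List.Relation.Unary.AllPairs.Properties as AllPairs
open import Data.List.Relation.Unary.Any using (here; there)
open import Data.Nat
open import Data.Nat.Properties
open import Data.Nat.Solver using (module +-*-Solver)
open import Data.Product using (Σ; ∃-syntax; _×_; _,_; proj₁; proj₂)
open import Data.Sum using (_⊎_; inj₁; inj₂; [_,_]′; swap; map; map₁)
open import Data.Unit using (⊤; tt)
open import Function using (_∘_; id)
open import Level using (0ℓ)
open import Relation.Binary using (Rel)
open import Relation.Binary.PropositionalEquality
open import Relation.Nullary using (¬_; yes; no)
open import Relation.Unary using (Pred; Decidable)
open import Relation.Unary.Properties using (∁?)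

open +-*-Solver using (solve; _:=_; _:+_; _:*_; con)

module Walks (G : Graph) where
  open Graph G

  infixr 5 _++ʷ_

  _++ʷ_ : ∀ {x y z} → Walk G x y → Walk G y z → Walk G x z
  [] ++ʷ w′ = w′
  (e ∷ w) ++ʷ w′ = e ∷ (w ++ʷ w′)

  len-++ʷ : ∀ {x y z} (w : Walk G x y) (w′ : Walk G y z) → len G (w ++ʷ w′) ≡ len G w + len G w′
  len-++ʷ [] w′ = refl
  len-++ʷ (e ∷ w) w′ = cong suc (len-++ʷ w w′)

  ∈-verts-++ʷ⁻ : ∀ {x y z v} (w : Walk G x y) (w′ : Walk G y z) →
    v ∈ verts G (w ++ʷ w′) → v ∈ verts G w ⊎ v ∈ verts G w′
  ∈-verts-++ʷ⁻ [] w′ v∈ = inj₂ v∈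
  ∈-verts-++ʷ⁻ (e ∷ w) w′ (here v≡x) = inj₁ (here v≡x)
  ∈-verts-++ʷ⁻ (e ∷ w) w′ (there v∈) = map₁ there (∈-verts-++ʷ⁻ w w′ v∈)

  source∈verts : ∀ {x y} (w : Walk G x y) → x ∈ verts G w
  source∈verts [] = here refl
  source∈verts (_ ∷ _) = here refl

  walk-meets-boundary : (Side Blk : V → Set) → Decidable Blk →
    (∀ {u v} → E u v → ¬ Blk u → ¬ Blk v → Side u → Side v) →
    ∀ {x z} (w : Walk G x z) → Side x → ¬ Side z → ∃[ v ] v ∈ verts G w × Blk v
  walk-meets-boundary Side Blk Blk? closed [] sx ¬sz = ⊥-elim (¬sz sx)
  walk-meets-boundary Side Blk Blk? closed {x} (_∷_ {y = y} e w) sx ¬sz with Blk? x | Blk? y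
  ... | yes bx | _ = x , here refl , bx
  ... | no _ | yes by = y , there (source∈verts w) , by
  ... | no ¬bx | no ¬by
    with v , v∈ , bv ← walk-meets-boundary Side Blk Blk? closed w (closed e ¬bx ¬by sx) ¬sz
    = v , there v∈ , bv

  ¬visible-across-boundary : (S Side Blk : V → Set) → Decidable Blk →
    (∀ {u v} → E u v → ¬ Blk u → ¬ Blk v → Side u → Side v) →
    ∀ {x z} → Visible G S x z → Side x → ¬ Side z →
    (∀ v → Blk v → S v × v ≢ x × v ≢ z) → ⊥
  ¬visible-across-boundary S Side Blk Blk? closed (P , _ , inner) sx ¬sz blk-inner
    with v , v∈ , bv ← walk-meets-boundary Side Blk Blk? closed P sx ¬sz
    with sv , v≢x , v≢z ← blk-inner v bv
    = [ v≢x , v≢z ]′ (inner v v∈ sv)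

  Potential : (V → ℕ) → Set
  Potential φ = ∀ {u v} → E u v → φ v ≤ suc (φ u)

  potential-≤-len : ∀ {φ} → Potential φ → ∀ {x z} (w : Walk G x z) → φ z ≤ φ x + len G w
  potential-≤-len {φ} pot {x} [] = ≤-reflexive (sym (+-identityʳ (φ x)))
  potential-≤-len {φ} pot {x} (_∷_ {y = y} e w) = begin
    _             ≤⟨ potential-≤-len pot w ⟩
    φ y + len G w ≤⟨ +-monoˡ-≤ (len G w) (pot e) ⟩
    suc (φ x) + len G w ≡⟨ sym (+-suc (φ x) (len G w)) ⟩
    φ x + suc (len G w) ∎
    where open ≤-Reasoning

  shortest-by-potential : ∀ {φ} → Potential φ → ∀ {x z} (w : Walk G x z) →
    φ x ≡ 0 → len G w ≤ φ z → IsShortest G w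
  shortest-by-potential {φ} pot {x} {z} w φx≡0 w≤φz Q =
    ≤-trans w≤φz (subst (λ a → φ z ≤ a + len G Q) φx≡0 (potential-≤-len pot Q))

  visible-refl : ∀ S x → Visible G S x x
  visible-refl S x = [] , (λ _ → z≤n) , λ { v (here v≡x) _ → inj₁ v≡x }

  visible-⊆ : ∀ {S S′} → (∀ v → S′ v → S v) → ∀ {x y} → Visible G S x y → Visible G S′ x y
  visible-⊆ S′⊆S (P , shortest , inner) = P , shortest , λ v v∈ s′ → inner v v∈ (S′⊆S v s′)

  module Symmetric (E-sym : ∀ {u v} → E u v → E v u) where

    reverse : ∀ {x y} → Walk G x y → Walk G y x
    reverse [] = []
    reverse (e ∷ w) = reverse w ++ʷ (E-sym e ∷ [])

    len-reverse : ∀ {x y} (w : Walk G x y) → len G (reverse w) ≡ len G w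
    len-reverse [] = refl
    len-reverse (e ∷ w) = begin
      len G (reverse w ++ʷ (E-sym e ∷ [])) ≡⟨ len-++ʷ (reverse w) (E-sym e ∷ []) ⟩
      len G (reverse w) + 1                ≡⟨ +-comm (len G (reverse w)) 1 ⟩
      suc (len G (reverse w))              ≡⟨ cong suc (len-reverse w) ⟩
      suc (len G w)                        ∎
      where open ≡-Reasoning

    ∈-verts-reverse⁻ : ∀ {x y v} (w : Walk G x y) → v ∈ verts G (reverse w) → v ∈ verts G w
    ∈-verts-reverse⁻ [] v∈ = v∈
    ∈-verts-reverse⁻ (e ∷ w) v∈ with ∈-verts-++ʷ⁻ (reverse w) (E-sym e ∷ []) v∈
    ... | inj₁ v∈′ = there (∈-verts-reverse⁻ w v∈′)
    ... | inj₂ (here refl) = there (source∈verts w)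
    ... | inj₂ (there (here v≡x)) = here v≡x

    visible-sym : ∀ {S x y} → Visible G S x y → Visible G S y x
    visible-sym (P , shortest , inner) =
      reverse P ,
      (λ Q → subst₂ _≤_ (sym (len-reverse P)) (len-reverse Q) (shortest (reverse Q))) ,
      λ v v∈ sv → swap (inner v (∈-verts-reverse⁻ P v∈) sv)

length-filter+∁ : ∀ {A : Set} {P : Pred A 0ℓ} (P? : Decidable P) (xs : List A) →
  length (filter P? xs) + length (filter (∁? P?) xs) ≡ length xs
length-filter+∁ P? [] = refl
length-filter+∁ P? (x ∷ xs) with P? x
... | yes _ = cong suc (length-filter+∁ P? xs)
... | no _ = trans (+-suc _ _) (cong suc (length-filter+∁ P? xs))

module WeightedPigeonhole
  {A B : Set} (_<ᴬ_ : Rel A 0ℓ) (_<ᴮ_ : Rel B 0ℓ) (f : A → ℕ) (g : B → ℕ) (a b c : ℕ)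
  (class-bound : ∀ n {ys xs} → AllPairs _<ᴬ_ ys → AllPairs _<ᴮ_ xs →
    All (λ y → f y ≡ n) ys → All (λ x → g x ≡ n) xs → a * length ys + b * length xs ≤ c)
  where

  weighted-count : ∀ m {ys xs} → AllPairs _<ᴬ_ ys → AllPairs _<ᴮ_ xs →
    All (λ y → f y < m) ys → All (λ x → g x < m) xs → a * length ys + b * length xs ≤ c * m
  weighted-count zero {[]} {[]} _ _ _ _ =
    ≤-reflexive (trans (cong₂ _+_ (*-zeroʳ a) (*-zeroʳ b)) (sym (*-zeroʳ c)))
  weighted-count zero {_ ∷ _} _ _ (() ∷ _) _
  weighted-count zero {[]} {_ ∷ _} _ _ _ (() ∷ _)
  weighted-count (suc m) {ys} {xs} ys↑ xs↑ fys<1+m gxs<1+m = begin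
    a * length ys + b * length xs
      ≡⟨ cong₂ (λ p q → a * p + b * q) (sym (length-filter+∁ f≟m ys)) (sym (length-filter+∁ g≟m xs)) ⟩
    a * (s₁ + r₁) + b * (s₂ + r₂)
      ≡⟨ solve 6 (λ a b s₁ r₁ s₂ r₂ → a :* (s₁ :+ r₁) :+ b :* (s₂ :+ r₂)
                   := (a :* s₁ :+ b :* s₂) :+ (a :* r₁ :+ b :* r₂)) refl a b s₁ r₁ s₂ r₂ ⟩
    (a * s₁ + b * s₂) + (a * r₁ + b * r₂)
      ≤⟨ +-mono-≤ (class-bound m (AllPairs.filter⁺ f≟m ys↑) (AllPairs.filter⁺ g≟m xs↑)
                                 (all-filter f≟m ys) (all-filter g≟m xs))
                  (weighted-count m (AllPairs.filter⁺ (∁? f≟m) ys↑) (AllPairs.filter⁺ (∁? g≟m) xs↑)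
                                    (below f≟m fys<1+m) (below g≟m gxs<1+m)) ⟩
    c + c * m
      ≡⟨ sym (*-suc c m) ⟩
    c * suc m ∎
    where
      open ≤-Reasoning
      f≟m : Decidable (λ y → f y ≡ m)
      f≟m y = f y ≟ m
      g≟m : Decidable (λ x → g x ≡ m)
      g≟m x = g x ≟ m
      s₁ = length (filter f≟m ys)
      r₁ = length (filter (∁? f≟m) ys)
      s₂ = length (filter g≟m xs)
      r₂ = length (filter (∁? g≟m) xs)
      below : ∀ {C : Set} {h : C → ℕ} (h≟m : Decidable (λ z → h z ≡ m)) {zs} →
        All (λ z → h z < suc m) zs → All (λ z → h z < m) (filter (∁? h≟m) zs)
      below h≟m {zs} h<1+m = All.zipWith (λ (h≢m , h<1+m) → ≤∧≢⇒< (s≤s⁻¹ h<1+m) h≢m)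
        (all-filter (∁? h≟m) zs , filter⁺ (∁? h≟m) h<1+m)

-- The weight of F_k is 2(2k - 1) + 4k = 8k - 2 > 4(2k - 1).
total-weight≤⇒ : ∀ k m → 2 * (2 * k ∸ 1) + 1 * (4 * k) ≤ 4 * m → 2 * k ≤ m
total-weight≤⇒ zero m _ = z≤n
total-weight≤⇒ (suc k) m weight≤4m =
  subst (_≤ m) (sym (*-suc 2 k)) (*-cancelˡ-< 4 (1 + 2 * k) m (begin-strict
    4 * (1 + 2 * k)                        <⟨ m<m+n (4 * (1 + 2 * k)) (s≤s z≤n) ⟩
    4 * (1 + 2 * k) + 2                    ≡⟨ solve 1 (λ k → con 4 :* (con 1 :+ con 2 :* k) :+ con 2
                                                := con 2 :* (con 1 :+ con 2 :* k) :+ con 1 :* (con 4 :* (con 1 :+ k)))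
                                                refl k ⟩
    2 * (1 + 2 * k) + 1 * (4 * suc k)      ≡⟨ cong (λ t → 2 * (t ∸ 1) + 1 * (4 * suc k)) (sym (*-suc 2 k)) ⟩
    2 * (2 * suc k ∸ 1) + 1 * (4 * suc k)  ≤⟨ weight≤4m ⟩
    4 * m                                  ∎))
  where open ≤-Reasoning

module FGraph (k : ℕ) where
  open Graph (F k)
  open Walks (F k) public

  E-sym : ∀ {u v} → E u v → E v u
  E-sym = swap

  open Symmetric E-sym public

  -- Indices are 0-based: x i is the paper's x_{i+1} and y t is y_{t+2}.
  x : Fin (4 * k) → V
  x = inj₁

  y : Fin (2 * k ∸ 1) → V
  y = inj₂

  x-injective : ∀ {i j} → toℕ i ≢ toℕ j → x i ≢ x j
  x-injective i≢j refl = i≢j refl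

  y-injective : ∀ {i j} → toℕ i ≢ toℕ j → y i ≢ y j
  y-injective i≢j refl = i≢j refl

  record Boundary : Set₁ where
    field
      Side Blk : V → Set
      Blk? : Decidable Blk
      closed : ∀ {u v} → FEdge k u v → ¬ Blk u → ¬ Blk v → (Side u → Side v) × (Side v → Side u)

    ¬visible-across : ∀ S {u w} → Visible (F k) S u w → Side u → ¬ Side w →
      (∀ v → Blk v → S v × v ≢ u × v ≢ w) → ⊥
    ¬visible-across S = ¬visible-across-boundary S Side Blk Blk? closed-E
      where
        closed-E : ∀ {u v} → E u v → ¬ Blk u → ¬ Blk v → Side u → Side v
        closed-E (inj₁ e) ¬bu ¬bv = proj₁ (closed e ¬bu ¬bv)
        closed-E (inj₂ e) ¬bu ¬bv = proj₂ (closed e ¬bv ¬bu)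

  -- The open arc x_lo … x_hi of the cycle that avoids x_0.
  arc : (lo hi : ℕ) → hi < 4 * k → Boundary
  arc lo hi hi<4k = record { Side = Side ; Blk = Blk ; Blk? = Blk? ; closed = closed }
    where
      Side : V → Set
      Side (inj₁ i) = lo < toℕ i × toℕ i < hi
      Side (inj₂ _) = ⊥
      Blk : V → Set
      Blk (inj₁ i) = toℕ i ≡ lo ⊎ toℕ i ≡ hi
      Blk (inj₂ _) = ⊥
      Blk? : Decidable Blk
      Blk? (inj₁ i) with toℕ i ≟ lo | toℕ i ≟ hi
      ... | yes i≡lo | _ = yes (inj₁ i≡lo)
      ... | no _ | yes i≡hi = yes (inj₂ i≡hi)
      ... | no i≢lo | no i≢hi = no [ i≢lo , i≢hi ]′
      Blk? (inj₂ _) = no λ ()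
      closed : ∀ {u v} → FEdge k u v → ¬ Blk u → ¬ Blk v → (Side u → Side v) × (Side v → Side u)
      closed (cyc {i} {j} j≡1+i) ¬bu ¬bv =
        (λ (lo<i , i<hi) → subst (lo <_) (sym j≡1+i) (m<n⇒m<1+n lo<i) ,
                           ≤∧≢⇒< (subst (_≤ hi) (sym j≡1+i) i<hi) (¬bv ∘ inj₂)) ,
        (λ (lo<j , j<hi) → ≤∧≢⇒< (s≤s⁻¹ (subst (lo <_) j≡1+i lo<j)) (¬bu ∘ inj₁ ∘ sym) ,
                           <-trans (n<1+n _) (subst (_< hi) j≡1+i j<hi))
      closed (wrap i≡4k-1 j≡0) _ _ =
        (λ (_ , i<hi) → ⊥-elim (<⇒≱ (subst (_< hi) i≡4k-1 i<hi) (<⇒≤pred hi<4k))) ,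
        (λ (lo<j , _) → ⊥-elim (n≮0 (subst (lo <_) j≡0 lo<j)))
      closed (path _) _ _ = (λ ()) , (λ ())
      closed (att i≡0 _) _ _ = (λ (lo<i , _) → ⊥-elim (n≮0 (subst (lo <_) i≡0 lo<i))) , (λ ())

  beyond : ℕ → Boundary
  beyond j = record { Side = Side ; Blk = Blk ; Blk? = Blk? ; closed = closed }
    where
      Side : V → Set
      Side (inj₁ _) = ⊥
      Side (inj₂ t) = j < toℕ t
      Blk : V → Set
      Blk (inj₁ _) = ⊥
      Blk (inj₂ t) = toℕ t ≡ j
      Blk? : Decidable Blk
      Blk? (inj₁ _) = no λ ()
      Blk? (inj₂ t) = toℕ t ≟ j
      closed : ∀ {u v} → FEdge k u v → ¬ Blk u → ¬ Blk v → (Side u → Side v) × (Side v → Side u)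
      closed (cyc _) _ _ = (λ ()) , (λ ())
      closed (wrap _ _) _ _ = (λ ()) , (λ ())
      closed (path t′≡1+t) ¬bu _ =
        (λ j<t → subst (j <_) (sym t′≡1+t) (m<n⇒m<1+n j<t)) ,
        (λ j<t′ → ≤∧≢⇒< (s≤s⁻¹ (subst (j <_) t′≡1+t j<t′)) (¬bu ∘ sym))
      closed (att _ t≡0) _ _ = (λ ()) , (λ j<t → ⊥-elim (n≮0 (subst (j <_) t≡0 j<t)))

  pendant : Boundary
  pendant = record { Side = Side ; Blk = Blk ; Blk? = Blk? ; closed = closed }
    where
      Side : V → Set
      Side (inj₁ _) = ⊥
      Side (inj₂ _) = ⊤
      Blk : V → Set
      Blk (inj₁ i) = toℕ i ≡ 0
      Blk (inj₂ _) = ⊥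
      Blk? : Decidable Blk
      Blk? (inj₁ i) = toℕ i ≟ 0
      Blk? (inj₂ _) = no λ ()
      closed : ∀ {u v} → FEdge k u v → ¬ Blk u → ¬ Blk v → (Side u → Side v) × (Side v → Side u)
      closed (cyc _) _ _ = (λ ()) , (λ ())
      closed (wrap _ _) _ _ = (λ ()) , (λ ())
      closed (path _) _ _ = (λ _ → tt) , (λ _ → tt)
      closed (att i≡0 _) ¬bu _ = ⊥-elim (¬bu i≡0)

  module MutualVisibility (S : V → Set) (mv : MutualVisibilitySet (F k) S) where

    no-three-y : ∀ {a b c} → toℕ a < toℕ b → toℕ b < toℕ c → S (y a) → S (y b) → S (y c) → ⊥
    no-three-y {a} {b} {c} a<b b<c sa sb sc =
      Boundary.¬visible-across (beyond (toℕ b)) S (mv (y c) (y a) sc sa) b<c (<⇒≯ a<b) blk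
      where
        blk : ∀ v → Boundary.Blk (beyond (toℕ b)) v → S v × v ≢ y c × v ≢ y a
        blk (inj₂ t) t≡b with refl ← toℕ-injective {i = t} {j = b} t≡b =
          sb , y-injective (<⇒≢ b<c) , y-injective (<⇒≢ a<b ∘ sym)

    no-two-y-one-x : ∀ {a b p} → toℕ a < toℕ b → S (y a) → S (y b) → S (x p) → ⊥
    no-two-y-one-x {a} {b} {p} a<b sa sb sp =
      Boundary.¬visible-across (beyond (toℕ a)) S (mv (y b) (x p) sb sp) a<b (λ ()) blk
      where
        blk : ∀ v → Boundary.Blk (beyond (toℕ a)) v → S v × v ≢ y b × v ≢ x p
        blk (inj₂ t) t≡a with refl ← toℕ-injective {i = t} {j = a} t≡a =
          sa , y-injective (<⇒≢ a<b) , λ ()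

    -- x_q is cut off from y_a by x_p when p = 0, and by x_p, x_r otherwise.
    no-one-y-three-x : ∀ {a p q r} → toℕ p < toℕ q → toℕ q < toℕ r →
      S (y a) → S (x p) → S (x q) → S (x r) → ⊥
    no-one-y-three-x {a} {p} {q} {r} p<q q<r sa sp sq sr with toℕ p ≟ 0
    ... | yes p≡0 =
      Boundary.¬visible-across pendant S (mv (y a) (x q) sa sq) tt (λ ()) blk
      where
        blk : ∀ v → Boundary.Blk pendant v → S v × v ≢ y a × v ≢ x q
        blk (inj₁ t) t≡0 with refl ← toℕ-injective {i = t} {j = p} (trans t≡0 (sym p≡0)) =
          sp , (λ ()) , x-injective (<⇒≢ p<q)
    ... | no _ =
      Boundary.¬visible-across (arc (toℕ p) (toℕ r) (toℕ<n r)) S (mv (x q) (y a) sq sa) (p<q , q<r) (λ ()) blk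
      where
        blk : ∀ v → Boundary.Blk (arc (toℕ p) (toℕ r) (toℕ<n r)) v → S v × v ≢ x q × v ≢ y a
        blk (inj₁ t) (inj₁ t≡p) with refl ← toℕ-injective {i = t} {j = p} t≡p =
          sp , x-injective (<⇒≢ p<q) , λ ()
        blk (inj₁ t) (inj₂ t≡r) with refl ← toℕ-injective {i = t} {j = r} t≡r =
          sr , x-injective (<⇒≢ q<r ∘ sym) , λ ()

    no-four-x : ∀ {p q r s} → toℕ p < toℕ q → toℕ q < toℕ r → toℕ r < toℕ s →
      S (x p) → S (x q) → S (x r) → S (x s) → ⊥
    no-four-x {p} {q} {r} {s} p<q q<r r<s sp sq sr ss =
      Boundary.¬visible-across (arc (toℕ q) (toℕ s) (toℕ<n s)) S (mv (x r) (x p) sr sp)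
        (q<r , r<s) (λ (q<p , _) → <⇒≯ p<q q<p) blk
      where
        blk : ∀ v → Boundary.Blk (arc (toℕ q) (toℕ s) (toℕ<n s)) v → S v × v ≢ x r × v ≢ x p
        blk (inj₁ t) (inj₁ t≡q) with refl ← toℕ-injective {i = t} {j = q} t≡q =
          sq , x-injective (<⇒≢ q<r) , x-injective (<⇒≢ p<q ∘ sym)
        blk (inj₁ t) (inj₂ t≡s) with refl ← toℕ-injective {i = t} {j = s} t≡s =
          ss , x-injective (<⇒≢ r<s ∘ sym) , x-injective (<⇒≢ (<-trans p<q (<-trans q<r r<s)) ∘ sym)

    weight≤4 : ∀ {ys xs} → AllPairs Fin._<_ ys → AllPairs Fin._<_ xs →
      All (S ∘ y) ys → All (S ∘ x) xs → 2 * length ys + 1 * length xs ≤ 4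
    weight≤4 {a ∷ b ∷ c ∷ _} ((a<b ∷ _) ∷ (b<c ∷ _) ∷ _) _ (sa ∷ sb ∷ sc ∷ _) _ = ⊥-elim (no-three-y a<b b<c sa sb sc)
    weight≤4 {_ ∷ _ ∷ []} {_ ∷ _} ((a<b ∷ _) ∷ _) _ (sa ∷ sb ∷ _) (sp ∷ _) = ⊥-elim (no-two-y-one-x a<b sa sb sp)
    weight≤4 {_ ∷ _ ∷ []} {[]} _ _ _ _ = ≤-refl
    weight≤4 {_ ∷ []} {_ ∷ _ ∷ _ ∷ _} _ ((p<q ∷ _) ∷ (q<r ∷ _) ∷ _) (sa ∷ _) (sp ∷ sq ∷ sr ∷ _) =
      ⊥-elim (no-one-y-three-x p<q q<r sa sp sq sr)
    weight≤4 {_ ∷ []} {_ ∷ _ ∷ []} _ _ _ _ = ≤-refl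
    weight≤4 {_ ∷ []} {_ ∷ []} _ _ _ _ = s≤s (s≤s (s≤s z≤n))
    weight≤4 {_ ∷ []} {[]} _ _ _ _ = s≤s (s≤s z≤n)
    weight≤4 {[]} {_ ∷ _ ∷ _ ∷ _ ∷ _} _ ((p<q ∷ _) ∷ (q<r ∷ _) ∷ (r<s ∷ _) ∷ _) _ (sp ∷ sq ∷ sr ∷ ss ∷ _) =
      ⊥-elim (no-four-x p<q q<r r<s sp sq sr ss)
    weight≤4 {[]} {_ ∷ _ ∷ _ ∷ []} _ _ _ _ = s≤s (s≤s (s≤s z≤n))
    weight≤4 {[]} {_ ∷ _ ∷ []} _ _ _ _ = s≤s (s≤s z≤n)
    weight≤4 {[]} {_ ∷ []} _ _ _ _ = s≤s z≤n
    weight≤4 {[]} {[]} _ _ _ _ = z≤n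

  lower-bound : ∀ m → MVColoring (F k) m → 2 * k ≤ m
  lower-bound m (c , c-mv) = total-weight≤⇒ k m (subst₂ (λ a b → 2 * a + 1 * b ≤ 4 * m)
    (length-tabulate {n = 2 * k ∸ 1} id) (length-tabulate {n = 4 * k} id) total-weight)
    where
      colour : V → ℕ
      colour v = toℕ (c v)
      class-mv : ∀ n → MutualVisibilitySet (F k) (λ v → colour v ≡ n)
      class-mv n u w cu≡n cw≡n = visible-⊆ (λ v cv≡n → toℕ-injective (trans cv≡n (sym cu≡n)))
        (c-mv (c u) u w refl (toℕ-injective (trans cw≡n (sym cu≡n))))
      open WeightedPigeonhole Fin._<_ Fin._<_ (colour ∘ y) (colour ∘ x) 2 1 4
        (λ n → MutualVisibility.weight≤4 _ (class-mv n))
      total-weight : 2 * length (allFin (2 * k ∸ 1)) + 1 * length (allFin (4 * k)) ≤ 4 * m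
      total-weight = weighted-count m (AllPairs.tabulate⁺-< id) (AllPairs.tabulate⁺-< id)
        (tabulate⁺ (toℕ<n ∘ c ∘ y)) (tabulate⁺ (toℕ<n ∘ c ∘ x))

Near : ℕ → ℕ → Set
Near a b = a ≤ suc b × b ≤ suc a

near-sym : ∀ {a b} → Near a b → Near b a
near-sym (a≤1+b , b≤1+a) = b≤1+a , a≤1+b

near-suc : ∀ a → Near a (suc a)
near-suc a = m≤n⇒m≤1+n (n≤1+n a) , ≤-refl

near-+ˡ : ∀ {a b} c → Near a b → Near (c + a) (c + b)
near-+ˡ {a} {b} c (a≤1+b , b≤1+a) =
  ≤-trans (+-monoʳ-≤ c a≤1+b) (≤-reflexive (+-suc c b)) ,
  ≤-trans (+-monoʳ-≤ c b≤1+a) (≤-reflexive (+-suc c a))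

near-⊓ : ∀ {a b c d} → Near a c → Near b d → Near (a ⊓ b) (c ⊓ d)
near-⊓ (a≤1+c , c≤1+a) (b≤1+d , d≤1+b) = ⊓-mono-≤ a≤1+c b≤1+d , ⊓-mono-≤ c≤1+a d≤1+b

∸-≤-suc : ∀ N a b → b ≤ suc a → N ∸ a ≤ suc (N ∸ b)
∸-≤-suc N a zero _ = ≤-trans (m∸n≤m N a) (n≤1+n N)
∸-≤-suc zero a (suc b) _ = ≤-trans (≤-reflexive (0∸n≡0 a)) z≤n
∸-≤-suc (suc N) zero (suc zero) _ = ≤-refl
∸-≤-suc (suc N) zero (suc (suc b)) (s≤s ())
∸-≤-suc (suc N) (suc a) (suc b) (s≤s b≤1+a) = ∸-≤-suc N a b b≤1+a

near-∸ˡ : ∀ c {a b} → Near a b → Near (c ∸ a) (c ∸ b)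
near-∸ˡ c {a} {b} (a≤1+b , b≤1+a) = ∸-≤-suc c a b b≤1+a , ∸-≤-suc c b a a≤1+b

near-∣-∣ : ∀ i s → Near ∣ i - s ∣ ∣ suc i - s ∣
near-∣-∣ zero zero = near-suc 0
near-∣-∣ (suc i) zero = near-suc (suc i)
near-∣-∣ zero (suc s) = near-sym (near-suc s)
near-∣-∣ (suc i) (suc s) = near-∣-∣ i s

-- The distance from position s to position i on a cycle of length N (for s, i < N).
cycleDist : ℕ → ℕ → ℕ → ℕ
cycleDist N s i = ∣ i - s ∣ ⊓ (N ∸ ∣ i - s ∣)

near-cycleDist-suc : ∀ N s i → Near (cycleDist N s i) (cycleDist N s (suc i))
near-cycleDist-suc N s i = near-⊓ (near-∣-∣ i s) (near-∸ˡ N (near-∣-∣ i s))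

near-cycleDist-wrap : ∀ P s → s ≤ P → Near (cycleDist (suc P) s P) (cycleDist (suc P) s 0)
near-cycleDist-wrap P s s≤P = subst₂ Near dist-P dist-0 (near-⊓ (near-suc (P ∸ s)) (near-sym (near-suc s)))
  where
    open ≡-Reasoning
    ∣P-s∣≡P∸s : ∣ P - s ∣ ≡ P ∸ s
    ∣P-s∣≡P∸s = m≤n⇒∣n-m∣≡n∸m s≤P
    dist-P : (P ∸ s) ⊓ suc s ≡ cycleDist (suc P) s P
    dist-P = cong₂ _⊓_ (sym ∣P-s∣≡P∸s) (sym (begin
      suc P ∸ ∣ P - s ∣ ≡⟨ cong (suc P ∸_) ∣P-s∣≡P∸s ⟩
      suc P ∸ (P ∸ s)   ≡⟨ +-∸-assoc 1 (m∸n≤m P s) ⟩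
      suc (P ∸ (P ∸ s)) ≡⟨ cong suc (m∸[m∸n]≡n s≤P) ⟩
      suc s             ∎))
    dist-0 : suc (P ∸ s) ⊓ s ≡ cycleDist (suc P) s 0
    dist-0 = begin
      suc (P ∸ s) ⊓ s           ≡⟨ ⊓-comm (suc (P ∸ s)) s ⟩
      s ⊓ suc (P ∸ s)           ≡⟨ cong (s ⊓_) (sym (+-∸-assoc 1 s≤P)) ⟩
      s ⊓ (suc P ∸ s)           ≡⟨ cong (λ d → d ⊓ (suc P ∸ d)) (sym (∣-∣-identityˡ s)) ⟩
      cycleDist (suc P) s 0     ∎

module Colouring (κ : ℕ) where
  k : ℕ
  k = suc κ

  open FGraph k
  open Graph (F k)

  N H P : ℕ
  N = 4 * k
  H = 2 * k
  P = pred N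

  N≡H+H : N ≡ H + H
  N≡H+H = solve 1 (λ k → con 4 :* k := con 2 :* k :+ con 2 :* k) refl k

  H<N : H < N
  H<N = subst (H <_) (sym N≡H+H) (m<m+n H (s≤s z≤n))

  ≤H⇒≤P : ∀ {l} → l ≤ H → l ≤ P
  ≤H⇒≤P l≤H = ≤-trans l≤H (s≤s⁻¹ H<N)

  N∸H≡H : N ∸ H ≡ H
  N∸H≡H = trans (cong (_∸ H) N≡H+H) (m+n∸n≡m H H)

  ≤H⇒H≤N∸ : ∀ {l} → l ≤ H → H ≤ N ∸ l
  ≤H⇒H≤N∸ {l} l≤H = subst (_≤ N ∸ l) N∸H≡H (∸-monoʳ-≤ N l≤H)

  ≤H⇒≤N∸ : ∀ {l} → l ≤ H → l ≤ N ∸ l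
  ≤H⇒≤N∸ l≤H = ≤-trans l≤H (≤H⇒H≤N∸ l≤H)

  ≥H⇒N∸≤ : ∀ {l} → H ≤ l → N ∸ l ≤ l
  ≥H⇒N∸≤ {l} H≤l = ≤-trans (subst (N ∸ l ≤_) N∸H≡H (∸-monoʳ-≤ N H≤l)) H≤l

  N∸[N∸l]≡l : ∀ {l} → l ≤ H → N ∸ (N ∸ l) ≡ l
  N∸[N∸l]≡l l≤H = m∸[m∸n]≡n (≤-trans l≤H (<⇒≤ H<N))

  cycleDist-≤H : ∀ {l} → l ≤ H → cycleDist N 0 l ≡ l
  cycleDist-≤H {l} l≤H = trans (cong (λ d → d ⊓ (N ∸ d)) (∣-∣-identityʳ l)) (m≤n⇒m⊓n≡m (≤H⇒≤N∸ l≤H))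

  cycleDist-≥H : ∀ {l} → H ≤ l → cycleDist N 0 l ≡ N ∸ l
  cycleDist-≥H {l} H≤l = trans (cong (λ d → d ⊓ (N ∸ d)) (∣-∣-identityʳ l)) (m≥n⇒m⊓n≡n (≥H⇒N∸≤ H≤l))

  cycleDist-opposite : ∀ {m} → m ≤ H → cycleDist N m (N ∸ m) ≡ (N ∸ (m + m)) ⊓ (m + m)
  cycleDist-opposite {m} m≤H = begin
    ∣ (N ∸ m) - m ∣ ⊓ (N ∸ ∣ (N ∸ m) - m ∣) ≡⟨ cong (λ d → d ⊓ (N ∸ d)) ∣N∸m-m∣≡N∸2m ⟩
    (N ∸ (m + m)) ⊓ (N ∸ (N ∸ (m + m)))     ≡⟨ cong ((N ∸ (m + m)) ⊓_) (m∸[m∸n]≡n 2m≤N) ⟩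
    (N ∸ (m + m)) ⊓ (m + m)                 ∎
    where
      open ≡-Reasoning
      ∣N∸m-m∣≡N∸2m : ∣ (N ∸ m) - m ∣ ≡ N ∸ (m + m)
      ∣N∸m-m∣≡N∸2m = trans (m≤n⇒∣n-m∣≡n∸m (≤H⇒≤N∸ m≤H)) (∸-+-assoc N m m)
      2m≤N : m + m ≤ N
      2m≤N = ≤-trans (+-monoˡ-≤ m (≤H⇒≤N∸ m≤H)) (≤-reflexive (m∸n+n≡m (≤-trans m≤H (<⇒≤ H<N))))

  near-potential : (φ : V → ℕ) → (∀ {u v} → FEdge k u v → Near (φ u) (φ v)) → Potential φ
  near-potential φ near (inj₁ e) = proj₂ (near e)
  near-potential φ near (inj₂ e) = proj₁ (near e)

  -- Lower bounds for the distance from x_s and from y_t.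
  distˣ : ℕ → V → ℕ
  distˣ s (inj₁ l) = cycleDist N s (toℕ l)
  distˣ s (inj₂ t) = cycleDist N s 0 + suc (toℕ t)

  distʸ : ℕ → V → ℕ
  distʸ t (inj₁ l) = suc t + cycleDist N 0 (toℕ l)
  distʸ t (inj₂ u) = t ∸ toℕ u

  distˣ-potential : ∀ s → s ≤ P → Potential (distˣ s)
  distˣ-potential s s≤P = near-potential (distˣ s) near
    where
      near : ∀ {u v} → FEdge k u v → Near (distˣ s u) (distˣ s v)
      near (cyc {i} j≡1+i) = subst (Near _) (cong (cycleDist N s) (sym j≡1+i)) (near-cycleDist-suc N s (toℕ i))
      near (wrap i≡P j≡0) = subst₂ Near (cong (cycleDist N s) (sym i≡P)) (cong (cycleDist N s) (sym j≡0))
        (near-cycleDist-wrap P s s≤P)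
      near (path {t} t′≡1+t) = subst (Near _) (cong (λ u → cycleDist N s 0 + suc u) (sym t′≡1+t))
        (near-+ˡ (cycleDist N s 0) (near-suc (suc (toℕ t))))
      near (att i≡0 t≡0) = subst₂ Near (cong (cycleDist N s) (sym i≡0)) (cong (λ u → cycleDist N s 0 + suc u) (sym t≡0))
        (subst (Near _) (+-comm 1 (cycleDist N s 0)) (near-suc (cycleDist N s 0)))

  distʸ-potential : ∀ t → Potential (distʸ t)
  distʸ-potential t = near-potential (distʸ t) near
    where
      near : ∀ {u v} → FEdge k u v → Near (distʸ t u) (distʸ t v)
      near (cyc {i} j≡1+i) = near-+ˡ (suc t)
        (subst (Near _) (cong (cycleDist N 0) (sym j≡1+i)) (near-cycleDist-suc N 0 (toℕ i)))
      near (wrap i≡P j≡0) = near-+ˡ (suc t)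
        (subst₂ Near (cong (cycleDist N 0) (sym i≡P)) (cong (cycleDist N 0) (sym j≡0)) (near-cycleDist-wrap P 0 z≤n))
      near (path {u} u′≡1+u) = subst (Near _) (cong (t ∸_) (sym u′≡1+u)) (near-∸ˡ t (near-suc (toℕ u)))
      near (att i≡0 u≡0) = subst₂ Near (cong (λ l → suc t + cycleDist N 0 l) (sym i≡0)) (cong (t ∸_) (sym u≡0))
        (subst (λ a → Near a t) (sym (+-identityʳ (suc t))) (near-sym (near-suc t)))

  OnArc : ℕ → ℕ → V → Set
  OnArc a b v = ∃[ l ] v ≡ x l × a ≤ toℕ l × toℕ l ≤ b

  private
    successor : ∀ d (i j : Fin N) → toℕ j ≡ toℕ i + suc d → ∃[ i′ ] toℕ i′ ≡ suc (toℕ i)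
    successor d i j j≡i+1+d = fromℕ< 1+i<N , toℕ-fromℕ< 1+i<N
      where
        open ≤-Reasoning
        1+i<N : suc (toℕ i) < N
        1+i<N = ≤-<-trans (begin
          suc (toℕ i)       ≤⟨ s≤s (m≤m+n (toℕ i) d) ⟩
          suc (toℕ i + d)   ≡⟨ sym (+-suc (toℕ i) d) ⟩
          toℕ i + suc d     ≡⟨ sym j≡i+1+d ⟩
          toℕ j             ∎) (toℕ<n j)

    predecessor : ∀ d (t : Fin (2 * k ∸ 1)) → toℕ t ≡ suc d → ∃[ t′ ] toℕ t′ ≡ d
    predecessor d t t≡1+d = fromℕ< d<M , toℕ-fromℕ< d<M
      where
        d<M : d < 2 * k ∸ 1
        d<M = <-trans (≤-reflexive (sym t≡1+d)) (toℕ<n t)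

  arcWalk : ∀ d (i j : Fin N) → toℕ j ≡ toℕ i + d →
    Σ (Walk (F k) (x i) (x j)) λ w → len (F k) w ≡ d × (∀ v → v ∈ verts (F k) w → OnArc (toℕ i) (toℕ j) v)
  arcWalk zero i j j≡i+0 with refl ← toℕ-injective {i = j} {j = i} (trans j≡i+0 (+-identityʳ _)) =
    [] , refl , λ { v (here v≡xi) → i , v≡xi , ≤-refl , ≤-refl }
  arcWalk (suc d) i j j≡i+1+d
    with i′ , i′≡1+i ← successor d i j j≡i+1+d
    with w , len-w , on-w ← arcWalk d i′ j (trans j≡i+1+d (trans (+-suc (toℕ i) d) (cong (_+ d) (sym i′≡1+i))))
    = inj₁ (cyc i′≡1+i) ∷ w , cong suc len-w , on-arc
    where
      on-arc : ∀ v → v ∈ verts (F k) (inj₁ (cyc i′≡1+i) ∷ w) → OnArc (toℕ i) (toℕ j) v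
      on-arc v (here v≡xi) = i , v≡xi , ≤-refl , ≤-trans (m≤m+n (toℕ i) (suc d)) (≤-reflexive (sym j≡i+1+d))
      on-arc v (there v∈) with l , v≡xl , i′≤l , l≤j ← on-w v v∈ =
        l , v≡xl , ≤-trans (n≤1+n (toℕ i)) (subst (_≤ toℕ l) i′≡1+i i′≤l) , l≤j

  OnPendant : ℕ → V → Set
  OnPendant d v = (∃[ u ] v ≡ y u × toℕ u ≤ d) ⊎ v ≡ x Fin.zero

  pendantWalk : ∀ d (t : Fin (2 * k ∸ 1)) → toℕ t ≡ d →
    Σ (Walk (F k) (y t) (x Fin.zero)) λ w → len (F k) w ≡ suc d × (∀ v → v ∈ verts (F k) w → OnPendant d v)
  pendantWalk zero t t≡0 = inj₂ (att refl t≡0) ∷ [] , refl , on-pendant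
    where
      on-pendant : ∀ v → v ∈ verts (F k) (inj₂ (att refl t≡0) ∷ []) → OnPendant zero v
      on-pendant v (here v≡yt) = inj₁ (t , v≡yt , ≤-reflexive t≡0)
      on-pendant v (there (here v≡x₀)) = inj₂ v≡x₀
  pendantWalk (suc d) t t≡1+d
    with t′ , t′≡d ← predecessor d t t≡1+d
    with w , len-w , on-w ← pendantWalk d t′ t′≡d
    = step ∷ w , cong suc len-w , on-pendant
    where
      step : E (y t) (y t′)
      step = inj₂ (path (trans t≡1+d (cong suc (sym t′≡d))))
      on-pendant : ∀ v → v ∈ verts (F k) (step ∷ w) → OnPendant (suc d) v
      on-pendant v (here v≡yt) = inj₁ (t , v≡yt , ≤-reflexive t≡1+d)
      on-pendant v (there v∈) = map₁ (λ (u , v≡yu , u≤d) → u , v≡yu , m≤n⇒m≤1+n u≤d) (on-w v v∈)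

  closingWalk : (j : Fin N) →
    Σ (Walk (F k) (x j) (x Fin.zero)) λ w → len (F k) w ≡ suc (P ∸ toℕ j) ×
      (∀ v → v ∈ verts (F k) w → OnArc (toℕ j) P v ⊎ v ≡ x Fin.zero)
  closingWalk j
    with w , len-w , on-w ← arcWalk (P ∸ toℕ j) j (fromℕ P)
      (trans (toℕ-fromℕ P) (sym (m+[n∸m]≡n (s≤s⁻¹ (toℕ<n j)))))
    = w ++ʷ (last ∷ []) , trans (len-++ʷ w (last ∷ [])) (trans (+-comm (len (F k) w) 1) (cong suc len-w)) , on-closing
    where
      last : E (x (fromℕ P)) (x Fin.zero)
      last = inj₁ (wrap (toℕ-fromℕ P) refl)
      on-closing : ∀ v → v ∈ verts (F k) (w ++ʷ (last ∷ [])) → OnArc (toℕ j) P v ⊎ v ≡ x Fin.zero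
      on-closing v v∈ with ∈-verts-++ʷ⁻ w (last ∷ []) v∈
      ... | inj₁ v∈w = inj₁ (subst (λ b → OnArc (toℕ j) b v) (toℕ-fromℕ P) (on-w v v∈w))
      ... | inj₂ (here v≡xP) = inj₁ (fromℕ P , v≡xP , subst (toℕ j ≤_) (sym (toℕ-fromℕ P)) (s≤s⁻¹ (toℕ<n j)) , ≤-reflexive (toℕ-fromℕ P))
      ... | inj₂ (there (here v≡x₀)) = inj₂ v≡x₀

  -- Colour n < 2k - 1 is used on y_n, x_{n+1} and x_{N-n-1}; colour 2k - 1 on x_0 and x_{2k}.
  colourˣ : ℕ → ℕ
  colourˣ zero = pred H
  colourˣ (suc l) = pred (cycleDist N 0 (suc l))

  colour : V → ℕ
  colour (inj₁ l) = colourˣ (toℕ l)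
  colour (inj₂ t) = toℕ t

  Class : ℕ → V → Set
  Class n v = colour v ≡ n

  colourˣ-low⁻¹ : ∀ {l n} → 0 < l → l ≤ H → colourˣ l ≡ n → l ≡ suc n
  colourˣ-low⁻¹ {suc l} _ 1+l≤H refl = cong suc (cong pred (sym (cycleDist-≤H 1+l≤H)))

  colourˣ-high⁻¹ : ∀ {l n} → H ≤ l → l < N → colourˣ l ≡ n → l ≡ N ∸ suc n
  colourˣ-high⁻¹ {suc l} {n} H≤1+l 1+l<N refl = begin
    suc l                       ≡⟨ sym (m∸[m∸n]≡n (<⇒≤ 1+l<N)) ⟩
    N ∸ (N ∸ suc l)             ≡⟨ cong (N ∸_) (sym (suc-pred (N ∸ suc l) {{>-nonZero (m<n⇒0<n∸m 1+l<N)}})) ⟩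
    N ∸ suc (pred (N ∸ suc l))  ≡⟨ cong (λ d → N ∸ suc (pred d)) (sym (cycleDist-≥H H≤1+l)) ⟩
    N ∸ suc n                   ∎
    where open ≡-Reasoning

  colourˣ<H : ∀ l → l < N → colourˣ l < H
  colourˣ<H zero _ = ≤-refl
  colourˣ<H (suc l) 1+l<N with suc l ≤? H
  ... | yes 1+l≤H = subst (_< H) (cong pred (sym (cycleDist-≤H 1+l≤H))) 1+l≤H
  ... | no 1+l≰H = subst (_< H) (cong pred (sym (cycleDist-≥H (<⇒≤ (≰⇒> 1+l≰H)))))
    (pred-< (subst (N ∸ suc l ≤_) N∸H≡H (∸-monoʳ-≤ N (<⇒≤ (≰⇒> 1+l≰H)))))
    where
      pred-< : ∀ {d} → d ≤ H → pred d < H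
      pred-< {zero} _ = s≤s z≤n
      pred-< {suc d} d<H = d<H

  x-≡ : ∀ {l i} → toℕ l ≡ toℕ i → x l ≡ x i
  x-≡ = cong x ∘ toℕ-injective

  on-pendant-in-class : ∀ {n t v} → toℕ t ≡ n → n ≢ pred H → OnPendant n v → Class n v → v ≡ y t
  on-pendant-in-class t≡n _ (inj₁ (u , refl , _)) u≡n = cong y (toℕ-injective (trans u≡n (sym t≡n)))
  on-pendant-in-class _ n≢pred[H] (inj₂ refl) pred[H]≡n = ⊥-elim (n≢pred[H] (sym pred[H]≡n))

  on-low-arc-in-class : ∀ {n i v} → toℕ i ≡ suc n → suc n ≤ H → n ≢ pred H →
    OnArc 0 (toℕ i) v → Class n v → v ≡ x i
  on-low-arc-in-class {i = i} i≡1+n 1+n≤H n≢pred[H] (l , refl , _ , l≤i) l∈Sₙ with toℕ l ≟ 0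
  ... | yes l≡0 = ⊥-elim (n≢pred[H] (trans (sym l∈Sₙ) (cong colourˣ l≡0)))
  ... | no l≢0 = x-≡ (trans (colourˣ-low⁻¹ (n≢0⇒n>0 l≢0) (≤-trans l≤i (subst (_≤ H) (sym i≡1+n) 1+n≤H)) l∈Sₙ) (sym i≡1+n))

  on-high-arc-in-class : ∀ {n j b v} → toℕ j ≡ N ∸ suc n → suc n ≤ H →
    OnArc (N ∸ suc n) b v → Class n v → v ≡ x j
  on-high-arc-in-class j≡N∸[1+n] 1+n≤H (l , refl , N∸[1+n]≤l , _) l∈Sₙ =
    x-≡ (trans (colourˣ-high⁻¹ (≤-trans (≤H⇒H≤N∸ 1+n≤H) N∸[1+n]≤l) (toℕ<n l) l∈Sₙ) (sym j≡N∸[1+n]))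

  on-closing-in-class : ∀ {n j v} → toℕ j ≡ N ∸ suc n → suc n ≤ H → n ≢ pred H →
    OnArc (toℕ j) P v ⊎ v ≡ x Fin.zero → Class n v → v ≡ x j
  on-closing-in-class j≡N∸[1+n] 1+n≤H _ (inj₁ on-arc) =
    on-high-arc-in-class j≡N∸[1+n] 1+n≤H (subst (λ a → OnArc a P _) j≡N∸[1+n] on-arc)
  on-closing-in-class _ _ n≢pred[H] (inj₂ refl) pred[H]≡n = ⊥-elim (n≢pred[H] (sym pred[H]≡n))

  closing-length : ∀ {n} {j : Fin N} → toℕ j ≡ N ∸ suc n → suc n ≤ H → suc (P ∸ toℕ j) ≡ suc n
  closing-length {n} j≡N∸[1+n] 1+n≤H = cong suc (trans (cong (P ∸_) j≡N∸[1+n]) (m∸[m∸n]≡n (≤H⇒≤P (<⇒≤ 1+n≤H))))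

  private
    y-colour<pred[H] : ∀ {n} {t : Fin (2 * k ∸ 1)} → toℕ t ≡ n → n < pred H
    y-colour<pred[H] {t = t} t≡n = subst (_< pred H) t≡n (toℕ<n t)

  visible-y-low : ∀ {n t i} → toℕ t ≡ n → toℕ i ≡ suc n → Visible (F k) (Class n) (y t) (x i)
  visible-y-low {n} {t} {i} t≡n i≡1+n
    with w₁ , len-w₁ , on-w₁ ← pendantWalk n t t≡n
    with w₂ , len-w₂ , on-w₂ ← arcWalk (suc n) Fin.zero i i≡1+n
    = w₁ ++ʷ w₂ , shortest , inner
    where
      n<pred[H] = y-colour<pred[H] t≡n
      1+n≤H : suc n ≤ H
      1+n≤H = ≤-trans n<pred[H] pred[n]≤n
      shortest : IsShortest (F k) (w₁ ++ʷ w₂)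
      shortest = shortest-by-potential (distʸ-potential n) (w₁ ++ʷ w₂) (trans (cong (n ∸_) t≡n) (n∸n≡0 n))
        (≤-reflexive (begin
          len (F k) (w₁ ++ʷ w₂)        ≡⟨ len-++ʷ w₁ w₂ ⟩
          len (F k) w₁ + len (F k) w₂  ≡⟨ cong₂ _+_ len-w₁ len-w₂ ⟩
          suc n + suc n                ≡⟨ cong (suc n +_) (sym (trans (cong (cycleDist N 0) i≡1+n) (cycleDist-≤H 1+n≤H))) ⟩
          distʸ n (x i)                ∎))
        where open ≡-Reasoning
      inner : ∀ v → v ∈ verts (F k) (w₁ ++ʷ w₂) → Class n v → v ≡ y t ⊎ v ≡ x i
      inner v v∈ v∈Sₙ = map
        (λ v∈w₁ → on-pendant-in-class t≡n (<⇒≢ n<pred[H]) (on-w₁ v v∈w₁) v∈Sₙ)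
        (λ v∈w₂ → on-low-arc-in-class i≡1+n 1+n≤H (<⇒≢ n<pred[H]) (on-w₂ v v∈w₂) v∈Sₙ)
        (∈-verts-++ʷ⁻ w₁ w₂ v∈)

  visible-y-high : ∀ {n t j} → toℕ t ≡ n → toℕ j ≡ N ∸ suc n → Visible (F k) (Class n) (y t) (x j)
  visible-y-high {n} {t} {j} t≡n j≡N∸[1+n]
    with w₁ , len-w₁ , on-w₁ ← pendantWalk n t t≡n
    with w₂ , len-w₂ , on-w₂ ← closingWalk j
    = w₁ ++ʷ reverse w₂ , shortest , inner
    where
      n<pred[H] = y-colour<pred[H] t≡n
      1+n≤H : suc n ≤ H
      1+n≤H = ≤-trans n<pred[H] pred[n]≤n
      shortest : IsShortest (F k) (w₁ ++ʷ reverse w₂)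
      shortest = shortest-by-potential (distʸ-potential n) (w₁ ++ʷ reverse w₂) (trans (cong (n ∸_) t≡n) (n∸n≡0 n))
        (≤-reflexive (begin
          len (F k) (w₁ ++ʷ reverse w₂)            ≡⟨ len-++ʷ w₁ (reverse w₂) ⟩
          len (F k) w₁ + len (F k) (reverse w₂)    ≡⟨ cong₂ _+_ len-w₁ (trans (len-reverse w₂) len-w₂) ⟩
          suc n + suc (P ∸ toℕ j)                  ≡⟨ cong (suc n +_) (closing-length j≡N∸[1+n] 1+n≤H) ⟩
          suc n + suc n                            ≡⟨ cong (suc n +_) (sym (N∸[N∸l]≡l 1+n≤H)) ⟩
          suc n + (N ∸ (N ∸ suc n))                ≡⟨ cong (suc n +_) (sym (trans (cong (cycleDist N 0) j≡N∸[1+n])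
                                                         (cycleDist-≥H (≤H⇒H≤N∸ 1+n≤H)))) ⟩
          distʸ n (x j)                            ∎))
        where open ≡-Reasoning
      inner : ∀ v → v ∈ verts (F k) (w₁ ++ʷ reverse w₂) → Class n v → v ≡ y t ⊎ v ≡ x j
      inner v v∈ v∈Sₙ = map
        (λ v∈w₁ → on-pendant-in-class t≡n (<⇒≢ n<pred[H]) (on-w₁ v v∈w₁) v∈Sₙ)
        (λ v∈w₂ → on-closing-in-class j≡N∸[1+n] 1+n≤H (<⇒≢ n<pred[H]) (on-w₂ v (∈-verts-reverse⁻ w₂ v∈w₂)) v∈Sₙ)
        (∈-verts-++ʷ⁻ w₁ (reverse w₂) v∈)

  private
    4m≡[m+m]+[m+m] : ∀ m → 4 * m ≡ (m + m) + (m + m)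
    4m≡[m+m]+[m+m] = solve 1 (λ m → con 4 :* m := (m :+ m) :+ (m :+ m)) refl

  -- For colour n with n + 1 ≤ k the short way from x_{n+1} to x_{N-n-1} passes x_0 ...
  visible-low-high-via-origin : ∀ {n i j} → toℕ i ≡ suc n → toℕ j ≡ N ∸ suc n → n ≢ pred H → suc n ≤ k →
    Visible (F k) (Class n) (x i) (x j)
  visible-low-high-via-origin {n} {i} {j} i≡1+n j≡N∸[1+n] n≢pred[H] 1+n≤k
    with w₁ , len-w₁ , on-w₁ ← arcWalk (suc n) Fin.zero i i≡1+n
    with w₂ , len-w₂ , on-w₂ ← closingWalk j
    = reverse w₁ ++ʷ reverse w₂ , shortest , inner
    where
      m = suc n
      m≤H : m ≤ H
      m≤H = ≤-trans 1+n≤k (m≤m+n k (k + 0))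
      2m≤N∸2m : m + m ≤ N ∸ (m + m)
      2m≤N∸2m = m+n≤o⇒m≤o∸n (m + m) (subst (_≤ N) (4m≡[m+m]+[m+m] m) (*-monoʳ-≤ 4 1+n≤k))
      shortest : IsShortest (F k) (reverse w₁ ++ʷ reverse w₂)
      shortest = shortest-by-potential (distˣ-potential m (≤H⇒≤P m≤H)) (reverse w₁ ++ʷ reverse w₂)
        (trans (cong (cycleDist N m) i≡1+n) (cong (λ d → d ⊓ (N ∸ d)) (∣n-n∣≡0 m)))
        (begin
          len (F k) (reverse w₁ ++ʷ reverse w₂)            ≡⟨ len-++ʷ (reverse w₁) (reverse w₂) ⟩
          len (F k) (reverse w₁) + len (F k) (reverse w₂)  ≡⟨ cong₂ _+_ (trans (len-reverse w₁) len-w₁)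
                                                               (trans (len-reverse w₂) (trans len-w₂ (closing-length j≡N∸[1+n] m≤H))) ⟩
          m + m                                            ≤⟨ ⊓-glb 2m≤N∸2m ≤-refl ⟩
          (N ∸ (m + m)) ⊓ (m + m)                          ≡⟨ sym (trans (cong (cycleDist N m) j≡N∸[1+n]) (cycleDist-opposite m≤H)) ⟩
          distˣ m (x j)                                    ∎)
        where open ≤-Reasoning
      inner : ∀ v → v ∈ verts (F k) (reverse w₁ ++ʷ reverse w₂) → Class n v → v ≡ x i ⊎ v ≡ x j
      inner v v∈ v∈Sₙ = map
        (λ v∈w₁ → on-low-arc-in-class i≡1+n m≤H n≢pred[H] (on-w₁ v (∈-verts-reverse⁻ w₁ v∈w₁)) v∈Sₙ)
        (λ v∈w₂ → on-closing-in-class j≡N∸[1+n] m≤H n≢pred[H] (on-w₂ v (∈-verts-reverse⁻ w₂ v∈w₂)) v∈Sₙ)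
        (∈-verts-++ʷ⁻ (reverse w₁) (reverse w₂) v∈)

  -- ... and for k ≤ n + 1 it is the arc between them that avoids x_0.
  visible-low-high-direct : ∀ {n i j} → toℕ i ≡ suc n → toℕ j ≡ N ∸ suc n → suc n ≤ H → k ≤ suc n →
    Visible (F k) (Class n) (x i) (x j)
  visible-low-high-direct {n} {i} {j} i≡1+n j≡N∸[1+n] 1+n≤H k≤1+n
    with w , len-w , on-w ← arcWalk (N ∸ suc n ∸ suc n) i j
      (trans j≡N∸[1+n] (trans (sym (m+[n∸m]≡n (≤H⇒≤N∸ 1+n≤H))) (cong (_+ (N ∸ suc n ∸ suc n)) (sym i≡1+n))))
    = w , shortest , inner
    where
      m = suc n
      N∸2m≤2m : N ∸ (m + m) ≤ m + m
      N∸2m≤2m = m≤n+o⇒m∸n≤o N (m + m) (subst (N ≤_) (4m≡[m+m]+[m+m] m) (*-monoʳ-≤ 4 k≤1+n))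
      shortest : IsShortest (F k) w
      shortest = shortest-by-potential (distˣ-potential m (≤H⇒≤P 1+n≤H)) w
        (trans (cong (cycleDist N m) i≡1+n) (cong (λ d → d ⊓ (N ∸ d)) (∣n-n∣≡0 m)))
        (begin
          len (F k) w               ≡⟨ trans len-w (∸-+-assoc N m m) ⟩
          N ∸ (m + m)               ≤⟨ ⊓-glb ≤-refl N∸2m≤2m ⟩
          (N ∸ (m + m)) ⊓ (m + m)   ≡⟨ sym (trans (cong (cycleDist N m) j≡N∸[1+n]) (cycleDist-opposite 1+n≤H)) ⟩
          distˣ m (x j)             ∎)
        where open ≤-Reasoning
      inner : ∀ v → v ∈ verts (F k) w → Class n v → v ≡ x i ⊎ v ≡ x j
      inner v v∈ v∈Sₙ with on-w v v∈
      ... | l , refl , i≤l , l≤j with toℕ l ≤? H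
      ...   | yes l≤H = inj₁ (x-≡ (trans (colourˣ-low⁻¹ (<-≤-trans (s≤s z≤n) (subst (_≤ toℕ l) i≡1+n i≤l)) l≤H v∈Sₙ)
                                          (sym i≡1+n)))
      ...   | no l≰H = inj₂ (x-≡ (trans (colourˣ-high⁻¹ (<⇒≤ (≰⇒> l≰H)) (toℕ<n l) v∈Sₙ) (sym j≡N∸[1+n])))

  visible-origin-middle : ∀ {i j} → toℕ i ≡ 0 → toℕ j ≡ H → Visible (F k) (Class (pred H)) (x i) (x j)
  visible-origin-middle {i} {j} i≡0 j≡H
    with w , len-w , on-w ← arcWalk H i j (trans j≡H (cong (_+ H) (sym i≡0)))
    = w , shortest , inner
    where
      shortest : IsShortest (F k) w
      shortest = shortest-by-potential (distˣ-potential 0 z≤n) w (cong (cycleDist N 0) i≡0)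
        (≤-reflexive (trans len-w (sym (trans (cong (cycleDist N 0) j≡H) (cycleDist-≤H ≤-refl)))))
      inner : ∀ v → v ∈ verts (F k) w → Class (pred H) v → v ≡ x i ⊎ v ≡ x j
      inner v v∈ v∈S with on-w v v∈
      ... | l , refl , _ , l≤j with toℕ l ≟ 0
      ...   | yes l≡0 = inj₁ (x-≡ (trans l≡0 (sym i≡0)))
      ...   | no l≢0 = inj₂ (x-≡ (trans (colourˣ-low⁻¹ (n≢0⇒n>0 l≢0) (subst (toℕ l ≤_) j≡H l≤j) v∈S) (sym j≡H)))

  data Member (n : ℕ) : V → Set where
    on-path : ∀ {t} → toℕ t ≡ n → Member n (y t)
    low     : ∀ {i} → toℕ i ≡ suc n → Member n (x i)
    high    : ∀ {i} → toℕ i ≡ N ∸ suc n → Member n (x i)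
    origin  : ∀ {i} → toℕ i ≡ 0 → n ≡ pred H → Member n (x i)

  member : ∀ {n} v → Class n v → Member n v
  member (inj₂ t) t≡n = on-path t≡n
  member (inj₁ l) l∈Sₙ with toℕ l ≟ 0 | toℕ l ≤? H
  ... | yes l≡0 | _ = origin l≡0 (trans (sym l∈Sₙ) (cong colourˣ l≡0))
  ... | no l≢0 | yes l≤H = low (colourˣ-low⁻¹ (n≢0⇒n>0 l≢0) l≤H l∈Sₙ)
  ... | no _ | no l≰H = high (colourˣ-high⁻¹ (<⇒≤ (≰⇒> l≰H)) (toℕ<n l) l∈Sₙ)

  visible-≡ : ∀ {S u w} → u ≡ w → Visible (F k) S u w
  visible-≡ {S} {u} refl = visible-refl S u

  visible-low-high : ∀ {n i j} → toℕ i ≡ suc n → toℕ j ≡ N ∸ suc n → n < H → Visible (F k) (Class n) (x i) (x j)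
  visible-low-high {n} i≡1+n j≡N∸[1+n] n<H with n ≟ pred H | suc n ≤? k
  ... | yes refl | _ = visible-≡ (x-≡ (trans i≡1+n (sym (trans j≡N∸[1+n] N∸H≡H))))
  ... | no n≢pred[H] | yes 1+n≤k = visible-low-high-via-origin i≡1+n j≡N∸[1+n] n≢pred[H] 1+n≤k
  ... | no _ | no 1+n≰k = visible-low-high-direct i≡1+n j≡N∸[1+n] n<H (<⇒≤ (≰⇒> 1+n≰k))

  visible-members : ∀ {n u w} → n < H → Member n u → Member n w → Visible (F k) (Class n) u w
  visible-members _ (on-path t≡n) (on-path t′≡n) = visible-≡ (cong y (toℕ-injective (trans t≡n (sym t′≡n))))
  visible-members _ (on-path t≡n) (low i≡1+n) = visible-y-low t≡n i≡1+n
  visible-members _ (low i≡1+n) (on-path t≡n) = visible-sym (visible-y-low t≡n i≡1+n)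
  visible-members _ (on-path t≡n) (high j≡N∸[1+n]) = visible-y-high t≡n j≡N∸[1+n]
  visible-members _ (high j≡N∸[1+n]) (on-path t≡n) = visible-sym (visible-y-high t≡n j≡N∸[1+n])
  visible-members _ (on-path t≡n) (origin _ n≡pred[H]) = ⊥-elim (<⇒≢ (y-colour<pred[H] t≡n) n≡pred[H])
  visible-members _ (origin _ n≡pred[H]) (on-path t≡n) = ⊥-elim (<⇒≢ (y-colour<pred[H] t≡n) n≡pred[H])
  visible-members _ (low i≡1+n) (low i′≡1+n) = visible-≡ (x-≡ (trans i≡1+n (sym i′≡1+n)))
  visible-members n<H (low i≡1+n) (high j≡N∸[1+n]) = visible-low-high i≡1+n j≡N∸[1+n] n<H
  visible-members n<H (high j≡N∸[1+n]) (low i≡1+n) = visible-sym (visible-low-high i≡1+n j≡N∸[1+n] n<H)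
  visible-members _ (origin i≡0 refl) (low j≡H) = visible-origin-middle i≡0 j≡H
  visible-members _ (low j≡H) (origin i≡0 refl) = visible-sym (visible-origin-middle i≡0 j≡H)
  visible-members _ (high j≡N∸[1+n]) (high j′≡N∸[1+n]) = visible-≡ (x-≡ (trans j≡N∸[1+n] (sym j′≡N∸[1+n])))
  visible-members _ (origin i≡0 refl) (high j≡N∸H) = visible-origin-middle i≡0 (trans j≡N∸H N∸H≡H)
  visible-members _ (high j≡N∸H) (origin i≡0 refl) = visible-sym (visible-origin-middle i≡0 (trans j≡N∸H N∸H≡H))
  visible-members _ (origin i≡0 _) (origin i′≡0 _) = visible-≡ (x-≡ (trans i≡0 (sym i′≡0)))

  colour<H : ∀ v → colour v < H
  colour<H (inj₁ l) = colourˣ<H (toℕ l) (toℕ<n l)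
  colour<H (inj₂ t) = <-≤-trans (toℕ<n t) pred[n]≤n

  colouring : MVColoring (F k) H
  colouring = c , c-mv
    where
      c : V → Fin H
      c v = fromℕ< (colour<H v)
      colour≡toℕ : ∀ {v i} → c v ≡ i → colour v ≡ toℕ i
      colour≡toℕ {v} refl = sym (toℕ-fromℕ< (colour<H v))
      c-mv : ∀ i → MutualVisibilitySet (F k) (λ v → c v ≡ i)
      c-mv i u w cu≡i cw≡i = visible-⊆ (λ v → colour≡toℕ {v})
        (visible-members (toℕ<n i) (member u (colour≡toℕ {u} cu≡i)) (member w (colour≡toℕ {w} cw≡i)))

proposition4p3 : (k : ℕ) → 2 ≤ k → ChiMuIs (F k) (2 * k)
proposition4p3 (suc κ) _ = Colouring.colouring κ , FGraph.lower-bound (suc κ)
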